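{- Let $\mathbf{a}<\mathbf{b}$ be two positive co-prime integers, $k$ a positive integer, and $\widetilde S$ the sumset semigroup generated by $\{0,k\mathbf{a}\}$ and $\{0,k\mathbf{b}\}$, with ideal $I_{\widetilde S}\subset\mathbf{k}[x,y]$ ($x$ corresponding to $\{0,k\mathbf{a}\}$, $y$ to $\{0,k\mathbf{b}\}$). Let $x^\alpha y^\beta-x^\gamma y^\delta\in I_{\widetilde S}\setminus\{0\}$. If $\alpha>\gamma$, then $\delta>\beta$, and there exists a positive integer $n$ such that $\alpha=n\mathbf{b}+\gamma$ and $\delta=n\mathbf{a}+\beta$.
   Context: For finite non-empty $A,B\subset\mathbb{N}$, $A+B=\{a+b\mid a\in A,b\in B\}$, and $\alpha\otimes A$ is the $\alpha$-fold sum of $A$ with itself ($0\otimes A=\{0\}$). The ideal of the sumset semigroup generated by $A_1,A_2$ is the binomial ideal $I\subset\mathbf{k}[x,y]$ ($\mathbf{k}$ a field) generated by all $x^{\alpha_1}y^{\alpha_2}-x^{\beta_1}y^{\beta_2}$ with $\alpha_1\otimes A_1+\alpha_2\otimes A_2=\beta_1\otimes A_1+\beta_2\otimes A_2$. -}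

module Defs where

open import Level using (Level; _⊔_)
open import Data.Nat as ℕ using (ℕ; zero; suc; _≡ᵇ_)
open import Data.Bool using (Bool; true; false; _∧_; if_then_else_)
open import Data.List using (List; []; _∷_; map; concatMap; foldr)
open import Data.List.Membership.Propositional using (_∈_)
open import Data.Product using (_×_; _,_; ∃)
open import Relation.Nullary using (¬_)
open import Algebra.Bundles using (CommutativeRing)

-- Sumsets of finite subsets of ℕ (represented by lists; compared as sets)

_⊕_ : List ℕ → List ℕ → List ℕ
A ⊕ B = concatMap (λ a → map (a ℕ.+_) B) A

_⊗_ : ℕ → List ℕ → List ℕ
zero  ⊗ A = 0 ∷ []
suc n ⊗ A = A ⊕ (n ⊗ A)

_≐_ : List ℕ → List ℕ → Set
A ≐ B = ∀ n → (n ∈ A → n ∈ B) × (n ∈ B → n ∈ A)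

SumsetRel : List ℕ → List ℕ → ℕ → ℕ → ℕ → ℕ → Set
SumsetRel A₁ A₂ α₁ α₂ β₁ β₂ = ((α₁ ⊗ A₁) ⊕ (α₂ ⊗ A₂)) ≐ ((β₁ ⊗ A₁) ⊕ (β₂ ⊗ A₂))

record IsField {c ℓ : Level} (R : CommutativeRing c ℓ) : Set (c ⊔ ℓ) where
  open CommutativeRing R
  field
    1≉0 : ¬ (1# ≈ 0#)
    inverse : ∀ x → ¬ (x ≈ 0#) → ∃ λ y → x * y ≈ 1#

-- Polynomials in k[x,y], given by their coefficient functions:
-- p i j is the coefficient of x^i y^j.

module Poly {c ℓ : Level} (R : CommutativeRing c ℓ) where
  open CommutativeRing R

  Pol : Set c
  Pol = ℕ → ℕ → Carrier

  mon : ℕ → ℕ → Pol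
  mon i j p q = if (p ≡ᵇ i) ∧ (q ≡ᵇ j) then 1# else 0#

  binom : ℕ → ℕ → ℕ → ℕ → Pol
  binom a b c' d p q = mon a b p q - mon c' d p q

  _≈P_ : Pol → Pol → Set ℓ
  f ≈P g = ∀ p q → f p q ≈ g p q

  0P : Pol
  0P p q = 0#

  -- A term of an ideal combination: c · x^i y^j · (generator).
  record Term (A₁ A₂ : List ℕ) : Set c where
    constructor term
    field
      coeff : Carrier
      i j : ℕ
      α₁ α₂ β₁ β₂ : ℕ
      rel : SumsetRel A₁ A₂ α₁ α₂ β₁ β₂

  evalTerm : ∀ {A₁ A₂} → Term A₁ A₂ → Pol
  evalTerm (term k i j α₁ α₂ β₁ β₂ _) p q =
    k * binom (i ℕ.+ α₁) (j ℕ.+ α₂) (i ℕ.+ β₁) (j ℕ.+ β₂) p q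

  evalTerms : ∀ {A₁ A₂} → List (Term A₁ A₂) → Pol
  evalTerms []       p q = 0#
  evalTerms (t ∷ ts) p q = evalTerm t p q + evalTerms ts p q

  -- membership in the ideal I ⊂ k[x,y] of the sumset semigroup generated
  -- by A₁, A₂: f is a k[x,y]-linear combination of the generators
  -- (every polynomial multiplier is a finite sum of terms c·x^i y^j).
  InSumsetIdeal : List ℕ → List ℕ → Pol → Set (c ⊔ ℓ)
  InSumsetIdeal A₁ A₂ f = ∃ λ (ts : List (Term A₁ A₂)) → f ≈P evalTerms ts

-- Give x the degree ka and y the degree kb. Every generator of the ideal is
-- homogeneous for this grading, since the largest element of
-- α₁ ⊗ {0, ka} + α₂ ⊗ {0, kb} is α₁ka + α₂kb. Hence the coefficients of any
-- element of the ideal sum to zero within each degree, which for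
-- x^α y^β − x^γ y^δ forces αka + βkb = γka + δkb. Cancelling k, coprimality
-- of a and b then gives α − γ = nb and δ − β = na.
module Submission where

open import Defs
open import Level using (Level)
open import Data.Nat using (ℕ; _+_; _*_; _<_; _>_)
open import Data.Nat.GCD using (gcd)
open import Data.List using (List; []; _∷_)
open import Data.Product using (_×_; _,_; ∃)
open import Relation.Nullary using (¬_)
open import Relation.Binary.PropositionalEquality using (_≡_)
open import Algebra.Bundles using (CommutativeRing)

open import Data.Nat using (zero; suc; _≤_; _∸_; _≟_; _≡ᵇ_; s≤s; z≤n; NonZero; >-nonZero)
import Data.Nat.Properties as ℕₚ
open import Data.Nat.Coprimality using (Coprime; gcd≡1⇒coprime; coprime-divisor)
import Data.Nat.Coprimality as Coprime
open import Data.Nat.Divisibility using (_∣_; divides; quotient)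
open import Data.Bool using (true; false; if_then_else_; T)
open import Data.Fin using (Fin; toℕ)
open import Data.Vec.Functional using (Vector)
open import Data.List using (map; _++_)
open import Data.List.Membership.Propositional using (_∈_)
open import Data.List.Membership.Propositional.Properties using (∈-map⁺; ∈-++⁺ˡ; ∈-++⁺ʳ)
open import Data.List.Relation.Unary.All as All using (All; []; _∷_)
open import Data.List.Relation.Unary.All.Properties using (++⁺; map⁺)
open import Data.List.Relation.Unary.Any using (here; there)
open import Data.Product using (proj₁; proj₂)
open import Data.Empty using (⊥-elim)
open import Relation.Nullary using (yes; no)
open import Relation.Nullary.Decidable using (does; dec-true; dec-false)
open import Relation.Binary.PropositionalEquality using (_≢_; refl; sym; trans; cong; cong₂; subst; module ≡-Reasoning)

deg : ℕ → ℕ → ℕ → ℕ → ℕ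
deg A B i j = i * A + j * B

deg-+ : ∀ A B i j i′ j′ → deg A B (i + i′) (j + j′) ≡ deg A B i j + deg A B i′ j′
deg-+ A B = solve 6 (λ A B i j i′ j′ → (i :+ i′) :* A :+ (j :+ j′) :* B
                                := (i :* A :+ j :* B) :+ (i′ :* A :+ j′ :* B)) refl A B
  where open import Data.Nat.Solver using (module +-*-Solver)
        open +-*-Solver

deg-boundˡ : ∀ A B i j .{{_ : NonZero A}} → i ≤ deg A B i j
deg-boundˡ A B i j = ℕₚ.≤-trans (ℕₚ.m≤m*n i A) (ℕₚ.m≤m+n (i * A) (j * B))

deg-boundʳ : ∀ A B i j .{{_ : NonZero B}} → j ≤ deg A B i j
deg-boundʳ A B i j = ℕₚ.≤-trans (ℕₚ.m≤m*n j B) (ℕₚ.m≤n+m (j * B) (i * A))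

≡ᵇ-true⇒≡ : ∀ m n → (m ≡ᵇ n) ≡ true → m ≡ n
≡ᵇ-true⇒≡ m n m≡ᵇn = ℕₚ.≡ᵇ⇒≡ m n (subst T (sym m≡ᵇn) _)

Maximum : ℕ → List ℕ → Set
Maximum m X = m ∈ X × All (_≤ m) X

⊕-∈ : ∀ {x y} X Y → x ∈ X → y ∈ Y → x + y ∈ X ⊕ Y
⊕-∈ (x ∷ X) Y (here refl) y∈Y = ∈-++⁺ˡ (∈-map⁺ (x +_) y∈Y)
⊕-∈ (x ∷ X) Y (there x∈X) y∈Y = ∈-++⁺ʳ (map (x +_) Y) (⊕-∈ X Y x∈X y∈Y)

⊕-bounded : ∀ {m n X Y} → All (_≤ m) X → All (_≤ n) Y → All (_≤ m + n) (X ⊕ Y)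
⊕-bounded []         Y≤n = []
⊕-bounded (x≤m ∷ X≤m) Y≤n = ++⁺ (map⁺ (All.map (ℕₚ.+-mono-≤ x≤m) Y≤n)) (⊕-bounded X≤m Y≤n)

⊕-maximum : ∀ {m n X Y} → Maximum m X → Maximum n Y → Maximum (m + n) (X ⊕ Y)
⊕-maximum {X = X} {Y} (m∈X , X≤m) (n∈Y , Y≤n) = ⊕-∈ X Y m∈X n∈Y , ⊕-bounded X≤m Y≤n

⊗-maximum : ∀ {m X} k → Maximum m X → Maximum (k * m) (k ⊗ X)
⊗-maximum zero    _     = here refl , ℕₚ.≤-refl ∷ []
⊗-maximum (suc k) max-X = ⊕-maximum max-X (⊗-maximum k max-X)

maximum-unique : ∀ {m n X Y} → X ≐ Y → Maximum m X → Maximum n Y → m ≡ n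
maximum-unique X≐Y (m∈X , X≤m) (n∈Y , Y≤n) =
  ℕₚ.≤-antisym (All.lookup Y≤n (proj₁ (X≐Y _) m∈X)) (All.lookup X≤m (proj₂ (X≐Y _) n∈Y))

maximum-pair : ∀ A → Maximum A (0 ∷ A ∷ [])
maximum-pair A = there (here refl) , z≤n ∷ ℕₚ.≤-refl ∷ []

deg-shift : ∀ A B i j {α₁ α₂ β₁ β₂} → deg A B α₁ α₂ ≡ deg A B β₁ β₂ →
            deg A B (i + α₁) (j + α₂) ≡ deg A B (i + β₁) (j + β₂)
deg-shift A B i j {α₁} {α₂} {β₁} {β₂} eq = begin
  deg A B (i + α₁) (j + α₂)       ≡⟨ deg-+ A B i j α₁ α₂ ⟩
  deg A B i j + deg A B α₁ α₂     ≡⟨ cong (deg A B i j +_) eq ⟩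
  deg A B i j + deg A B β₁ β₂     ≡⟨ sym (deg-+ A B i j β₁ β₂) ⟩
  deg A B (i + β₁) (j + β₂)       ∎
  where open ≡-Reasoning

sumsetRel⇒deg≡ : ∀ {A B X Y} α₁ α₂ β₁ β₂ → Maximum A X → Maximum B Y →
                 SumsetRel X Y α₁ α₂ β₁ β₂ → deg A B α₁ α₂ ≡ deg A B β₁ β₂
sumsetRel⇒deg≡ α₁ α₂ β₁ β₂ max-X max-Y rel = maximum-unique rel
  (⊕-maximum (⊗-maximum α₁ max-X) (⊗-maximum α₂ max-Y))
  (⊕-maximum (⊗-maximum β₁ max-X) (⊗-maximum β₂ max-Y))

module DegreeComponent {c ℓ : Level} (R : CommutativeRing c ℓ) (A B : ℕ) .{{_ : NonZero A}} .{{_ : NonZero B}} where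
  open CommutativeRing R
    renaming (_+_ to _+ᴿ_; _*_ to _*ᴿ_; refl to ≈-refl; sym to ≈-sym; trans to ≈-trans)
  open Poly R
  open import Algebra.Properties.Ring ring using (-1*x≈-x; x∙y⁻¹≈ε⇒x≈y)
  open import Algebra.Properties.CommutativeSemigroup *-commutativeSemigroup using (x∙yz≈y∙xz)
  open import Algebra.Properties.Semiring.Sum semiring
    using (sum; sum-syntax; sum-cong-≋; sum-replicate-zero; ∑-distrib-+; *-distribˡ-sum)
  open import Relation.Binary.Reasoning.Setoid setoid

  ∑-indicator : ∀ {n} i → i < n → ∑[ p < n ] (if toℕ p ≡ᵇ i then 1# else 0#) ≈ 1#
  ∑-indicator {suc n} zero    _         = ≈-trans (+-congˡ (sum-replicate-zero n)) (+-identityʳ 1#)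
  ∑-indicator {suc n} (suc i) (s≤s i<n) = ≈-trans (+-identityˡ _) (∑-indicator i i<n)

  ∑-mon : ∀ {n} i j p → j < n → ∑[ q < n ] mon i j p (toℕ q) ≈ (if p ≡ᵇ i then 1# else 0#)
  ∑-mon {n} i j p j<n with p ≡ᵇ i
  ... | true  = ∑-indicator j j<n
  ... | false = sum-replicate-zero n

  grid : ∀ n → Pol → Fin n → Vector Carrier n
  grid n F p q = F (toℕ p) (toℕ q)

  box : ℕ → Pol → Carrier
  box n F = ∑[ p < n ] sum (grid n F p)

  box-cong : ∀ n {F G} → F ≈P G → box n F ≈ box n G
  box-cong n F≈G = sum-cong-≋ {n} (λ p → sum-cong-≋ {n} (λ q → F≈G (toℕ p) (toℕ q)))

  box-+ : ∀ n F G → box n (λ p q → F p q +ᴿ G p q) ≈ box n F +ᴿ box n G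
  box-+ n F G = ≈-trans (sum-cong-≋ {n} (λ p → ∑-distrib-+ (grid n F p) (grid n G p)))
                        (∑-distrib-+ (λ p → sum (grid n F p)) (λ p → sum (grid n G p)))

  box-* : ∀ n x F → box n (λ p q → x *ᴿ F p q) ≈ x *ᴿ box n F
  box-* n x F = ≈-sym (≈-trans (*-distribˡ-sum x (λ p → sum (grid n F p)))
                               (sum-cong-≋ {n} (λ p → *-distribˡ-sum x (grid n F p))))

  box-mon : ∀ n i j → i < n → j < n → box n (mon i j) ≈ 1#
  box-mon n i j i<n j<n = begin
    box n (mon i j)                                ≈⟨ sum-cong-≋ {n} (λ p → ∑-mon i j (toℕ p) j<n) ⟩
    ∑[ p < n ] (if toℕ p ≡ᵇ i then 1# else 0#)   ≈⟨ ∑-indicator i i<n ⟩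
    1#                                             ∎

  module _ (d : ℕ) where

    indicator : ℕ → Carrier
    indicator e = if does (e ≟ d) then 1# else 0#

    weighted : Pol → Pol
    weighted F p q = indicator (deg A B p q) *ᴿ F p q

    -- The box [0, d]² contains every monomial of degree d because A, B ≠ 0.
    coeffSum : Pol → Carrier
    coeffSum F = box (suc d) (weighted F)

    coeffSum-cong : ∀ {F G} → F ≈P G → coeffSum F ≈ coeffSum G
    coeffSum-cong F≈G = box-cong (suc d) (λ p q → *-congˡ {indicator (deg A B p q)} (F≈G p q))

    coeffSum-+ : ∀ F G → coeffSum (λ p q → F p q +ᴿ G p q) ≈ coeffSum F +ᴿ coeffSum G
    coeffSum-+ F G = ≈-trans (box-cong (suc d) (λ p q → distribˡ (indicator (deg A B p q)) (F p q) (G p q)))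
                             (box-+ (suc d) (weighted F) (weighted G))

    coeffSum-* : ∀ x F → coeffSum (λ p q → x *ᴿ F p q) ≈ x *ᴿ coeffSum F
    coeffSum-* x F = ≈-trans (box-cong (suc d) (λ p q → x∙yz≈y∙xz (indicator (deg A B p q)) x (F p q)))
                             (box-* (suc d) x (weighted F))

    coeffSum-neg : ∀ F → coeffSum (λ p q → - F p q) ≈ - coeffSum F
    coeffSum-neg F = begin
      coeffSum (λ p q → - F p q)       ≈⟨ coeffSum-cong (λ p q → ≈-sym (-1*x≈-x (F p q))) ⟩
      coeffSum (λ p q → - 1# *ᴿ F p q) ≈⟨ coeffSum-* (- 1#) F ⟩
      - 1# *ᴿ coeffSum F               ≈⟨ -1*x≈-x _ ⟩
      - coeffSum F                     ∎

    coeffSum-0 : coeffSum 0P ≈ 0#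
    coeffSum-0 = begin
      coeffSum 0P                      ≈⟨ coeffSum-cong (λ p q → ≈-sym (zeroˡ 0#)) ⟩
      coeffSum (λ p q → 0# *ᴿ 0P p q)  ≈⟨ coeffSum-* 0# 0P ⟩
      0# *ᴿ coeffSum 0P                ≈⟨ zeroˡ _ ⟩
      0#                               ∎

    weighted-mon : ∀ i j → weighted (mon i j) ≈P (λ p q → indicator (deg A B i j) *ᴿ mon i j p q)
    weighted-mon i j p q with p ≡ᵇ i in p≡ᵇi | q ≡ᵇ j in q≡ᵇj
    ... | true  | true  = *-congʳ (reflexive (cong indicator
                            (cong₂ (deg A B) (≡ᵇ-true⇒≡ p i p≡ᵇi) (≡ᵇ-true⇒≡ q j q≡ᵇj))))
    ... | true  | false = ≈-trans (zeroʳ _) (≈-sym (zeroʳ _))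
    ... | false | _     = ≈-trans (zeroʳ _) (≈-sym (zeroʳ _))

    indicator-self : indicator d ≡ 1#
    indicator-self rewrite dec-true (d ≟ d) refl = refl

    indicator-other : ∀ {e} → e ≢ d → indicator e ≡ 0#
    indicator-other {e} e≢d rewrite dec-false (e ≟ d) e≢d = refl

    indicator-box-mon : ∀ i j → indicator (deg A B i j) *ᴿ box (suc d) (mon i j) ≈ indicator (deg A B i j)
    indicator-box-mon i j with deg A B i j ≟ d
    ... | no ne = begin
      indicator (deg A B i j) *ᴿ box (suc d) (mon i j) ≈⟨ *-congʳ (reflexive (indicator-other ne)) ⟩
      0# *ᴿ box (suc d) (mon i j)                      ≈⟨ zeroˡ _ ⟩
      0#                                               ≡⟨ indicator-other ne ⟨
      indicator (deg A B i j)                          ∎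
    ... | yes e = begin
      indicator (deg A B i j) *ᴿ box (suc d) (mon i j) ≈⟨ *-cong (reflexive indicator≡1) (box-mon (suc d) i j i<1+d j<1+d) ⟩
      1# *ᴿ 1#                                         ≈⟨ *-identityʳ 1# ⟩
      1#                                               ≡⟨ indicator≡1 ⟨
      indicator (deg A B i j)                          ∎
      where
      indicator≡1 = trans (cong indicator e) indicator-self
      i<1+d = s≤s (ℕₚ.≤-trans (deg-boundˡ A B i j) (ℕₚ.≤-reflexive e))
      j<1+d = s≤s (ℕₚ.≤-trans (deg-boundʳ A B i j) (ℕₚ.≤-reflexive e))

    coeffSum-mon : ∀ i j → coeffSum (mon i j) ≈ indicator (deg A B i j)
    coeffSum-mon i j = begin
      coeffSum (mon i j)                                          ≈⟨ box-cong (suc d) (weighted-mon i j) ⟩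
      box (suc d) (λ p q → indicator (deg A B i j) *ᴿ mon i j p q) ≈⟨ box-* (suc d) _ (mon i j) ⟩
      indicator (deg A B i j) *ᴿ box (suc d) (mon i j)           ≈⟨ indicator-box-mon i j ⟩
      indicator (deg A B i j)                                     ∎

    coeffSum-binom : ∀ i j i′ j′ →
      coeffSum (binom i j i′ j′) ≈ indicator (deg A B i j) - indicator (deg A B i′ j′)
    coeffSum-binom i j i′ j′ = ≈-trans (coeffSum-+ (mon i j) (λ p q → - mon i′ j′ p q))
      (+-cong (coeffSum-mon i j) (≈-trans (coeffSum-neg (mon i′ j′)) (-‿cong (coeffSum-mon i′ j′))))

    coeffSum-evalTerms : ∀ {X Y} → Maximum A X → Maximum B Y →
                         (ts : List (Term X Y)) → coeffSum (evalTerms ts) ≈ 0#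
    coeffSum-evalTerms max-X max-Y [] = coeffSum-0
    coeffSum-evalTerms max-X max-Y (t@(term k i j α₁ α₂ β₁ β₂ rel) ∷ ts) = begin
      coeffSum (evalTerms (t ∷ ts))                   ≈⟨ coeffSum-+ (evalTerm t) (evalTerms ts) ⟩
      coeffSum (evalTerm t) +ᴿ coeffSum (evalTerms ts) ≈⟨ +-cong coeffSum-term (coeffSum-evalTerms max-X max-Y ts) ⟩
      0# +ᴿ 0#                                         ≈⟨ +-identityʳ 0# ⟩
      0#                                               ∎
      where
      coeffSum-term : coeffSum (evalTerm t) ≈ 0#
      coeffSum-term = begin
        coeffSum (evalTerm t)
          ≈⟨ coeffSum-* k (binom (i + α₁) (j + α₂) (i + β₁) (j + β₂)) ⟩
        k *ᴿ coeffSum (binom (i + α₁) (j + α₂) (i + β₁) (j + β₂))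
          ≈⟨ *-congˡ (coeffSum-binom (i + α₁) (j + α₂) (i + β₁) (j + β₂)) ⟩
        k *ᴿ (indicator (deg A B (i + α₁) (j + α₂)) - indicator (deg A B (i + β₁) (j + β₂)))
          ≈⟨ *-congˡ (+-congʳ (reflexive (cong indicator shifted-deg≡))) ⟩
        k *ᴿ (indicator (deg A B (i + β₁) (j + β₂)) - indicator (deg A B (i + β₁) (j + β₂)))
          ≈⟨ *-congˡ (-‿inverseʳ _) ⟩
        k *ᴿ 0#
          ≈⟨ zeroʳ k ⟩
        0# ∎
        where
        shifted-deg≡ = deg-shift A B i j (sumsetRel⇒deg≡ α₁ α₂ β₁ β₂ max-X max-Y rel)

  binom∈ideal⇒deg≡ : ¬ (1# ≈ 0#) → ∀ {X Y} → Maximum A X → Maximum B Y → ∀ α β γ δ →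
                     InSumsetIdeal X Y (binom α β γ δ) → deg A B γ δ ≡ deg A B α β
  binom∈ideal⇒deg≡ 1≉0 max-X max-Y α β γ δ (ts , binom≈) with deg A B γ δ ≟ deg A B α β
  ... | yes eq  = eq
  ... | no  neq = ⊥-elim (1≉0 (begin
    1#                                   ≡⟨ sym (indicator-self d) ⟩
    indicator d d                        ≈⟨ x∙y⁻¹≈ε⇒x≈y _ _ indicator-difference ⟩
    indicator d (deg A B γ δ)            ≡⟨ indicator-other d neq ⟩
    0#                                   ∎))
    where
    d = deg A B α β
    indicator-difference : indicator d d - indicator d (deg A B γ δ) ≈ 0#
    indicator-difference = begin
      indicator d d - indicator d (deg A B γ δ) ≈⟨ coeffSum-binom d α β γ δ ⟨
      coeffSum d (binom α β γ δ)                ≈⟨ coeffSum-cong d binom≈ ⟩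
      coeffSum d (evalTerms ts)                 ≈⟨ coeffSum-evalTerms d max-X max-Y ts ⟩
      0#                                        ∎

∸-exchange : ∀ A B α β γ δ → deg A B α β ≡ deg A B γ δ → (α ∸ γ) * A ≡ (δ ∸ β) * B
∸-exchange A B α β γ δ eq = begin
  (α ∸ γ) * A                     ≡⟨ ℕₚ.*-distribʳ-∸ A α γ ⟩
  α * A ∸ γ * A                   ≡⟨ ℕₚ.[m+n]∸[m+o]≡n∸o (β * B) (α * A) (γ * A) ⟨
  β * B + α * A ∸ (β * B + γ * A) ≡⟨ cong₂ _∸_ (ℕₚ.+-comm (β * B) (α * A)) (ℕₚ.+-comm (β * B) (γ * A)) ⟩
  α * A + β * B ∸ (γ * A + β * B) ≡⟨ cong (_∸ (γ * A + β * B)) eq ⟩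
  γ * A + δ * B ∸ (γ * A + β * B) ≡⟨ ℕₚ.[m+n]∸[m+o]≡n∸o (γ * A) (δ * B) (β * B) ⟩
  δ * B ∸ β * B                   ≡⟨ ℕₚ.*-distribʳ-∸ B δ β ⟨
  (δ ∸ β) * B                     ∎
  where open ≡-Reasoning

<-exchange : ∀ A B {α β γ δ} .{{_ : NonZero A}} → γ < α → deg A B α β ≡ deg A B γ δ → β < δ
<-exchange A B {α} {β} {γ} {δ} γ<α eq = ℕₚ.*-cancelʳ-< B β δ (ℕₚ.+-cancelˡ-< (γ * A) (β * B) (δ * B) (begin-strict
  γ * A + β * B <⟨ ℕₚ.+-monoˡ-< (β * B) (ℕₚ.*-monoˡ-< A γ<α) ⟩
  α * A + β * B ≡⟨ eq ⟩
  γ * A + δ * B ∎))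
  where open ℕₚ.≤-Reasoning

*-cancel-common : ∀ k a b e f .{{_ : NonZero k}} → e * (k * a) ≡ f * (k * b) → e * a ≡ f * b
*-cancel-common k a b e f eq = ℕₚ.*-cancelˡ-≡ (e * a) (f * b) k (begin
  k * (e * a) ≡⟨ x∙yz≈y∙xz k e a ⟩
  e * (k * a) ≡⟨ eq ⟩
  f * (k * b) ≡⟨ x∙yz≈y∙xz f k b ⟩
  k * (f * b) ∎)
  where
  open ≡-Reasoning
  open import Algebra.Properties.CommutativeSemigroup ℕₚ.*-commutativeSemigroup using (x∙yz≈y∙xz)

coprime-*-≡ : ∀ {a b e f} .{{_ : NonZero b}} → Coprime a b → e * a ≡ f * b →
              ∃ λ n → e ≡ n * b × f ≡ n * a
coprime-*-≡ {a} {b} {e} {f} coprime ea≡fb = n , e≡nb , f≡na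
  where
  b∣e : b ∣ e
  b∣e = coprime-divisor (Coprime.sym coprime) (divides f (trans (ℕₚ.*-comm a e) ea≡fb))
  n = quotient b∣e
  e≡nb : e ≡ n * b
  e≡nb = _∣_.equality b∣e
  f≡na : f ≡ n * a
  f≡na = ℕₚ.*-cancelʳ-≡ f (n * a) b (begin
    f * b     ≡⟨ ea≡fb ⟨
    e * a     ≡⟨ cong (_* a) e≡nb ⟩
    n * b * a ≡⟨ xy∙z≈xz∙y n b a ⟩
    n * a * b ∎)
    where
    open ≡-Reasoning
    open import Algebra.Properties.CommutativeSemigroup ℕₚ.*-commutativeSemigroup using (xy∙z≈xz∙y)

∸≡⇒≡+ : ∀ {m n o} → m ≤ n → n ∸ m ≡ o → n ≡ o + m
∸≡⇒≡+ m≤n refl = sym (ℕₚ.m∸n+n≡m m≤n)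

lemma7 : {c ℓ : Level} (R : CommutativeRing c ℓ) → IsField R →
         (a b k : ℕ) → 0 < a → a < b → gcd a b ≡ 1 → 0 < k →
         (α β γ δ : ℕ) →
         Poly.InSumsetIdeal R (0 ∷ k * a ∷ []) (0 ∷ k * b ∷ []) (Poly.binom R α β γ δ) →
         ¬ (Poly._≈P_ R (Poly.binom R α β γ δ) (Poly.0P R)) →
         α > γ →
         (δ > β) × ∃ λ n → (0 < n) × (α ≡ n * b + γ) × (δ ≡ n * a + β)
lemma7 R isField a b k 0<a a<b gcd≡1 0<k α β γ δ binom∈I _ γ<α =
  β<δ , n , 0<n , ∸≡⇒≡+ (ℕₚ.<⇒≤ γ<α) α∸γ≡nb , ∸≡⇒≡+ (ℕₚ.<⇒≤ β<δ) δ∸β≡na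
  where
  instance
    k≢0 : NonZero k
    k≢0 = >-nonZero 0<k
    a≢0 : NonZero a
    a≢0 = >-nonZero 0<a
    b≢0 : NonZero b
    b≢0 = >-nonZero (ℕₚ.<-trans 0<a a<b)
    ka≢0 : NonZero (k * a)
    ka≢0 = ℕₚ.m*n≢0 k a
    kb≢0 : NonZero (k * b)
    kb≢0 = ℕₚ.m*n≢0 k b
  open DegreeComponent R (k * a) (k * b) using (binom∈ideal⇒deg≡)
  deg≡ : deg (k * a) (k * b) α β ≡ deg (k * a) (k * b) γ δ
  deg≡ = sym (binom∈ideal⇒deg≡ (IsField.1≉0 isField) (maximum-pair (k * a)) (maximum-pair (k * b))
                               α β γ δ binom∈I)
  β<δ : β < δ
  β<δ = <-exchange (k * a) (k * b) γ<α deg≡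
  solution : ∃ λ n → α ∸ γ ≡ n * b × δ ∸ β ≡ n * a
  solution = coprime-*-≡ (gcd≡1⇒coprime gcd≡1)
               (*-cancel-common k a b (α ∸ γ) (δ ∸ β) (∸-exchange (k * a) (k * b) α β γ δ deg≡))
  n = proj₁ solution
  α∸γ≡nb = proj₁ (proj₂ solution)
  δ∸β≡na = proj₂ (proj₂ solution)
  0<n : 0 < n
  0<n = ℕₚ.*-cancelʳ-< b 0 n (subst (0 <_) α∸γ≡nb (ℕₚ.m<n⇒0<n∸m γ<α))
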